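{- Let $G$ be a square and let $H$ be any graph. Then the tensor (direct) product $G\times H$ is a square.
   Context: $G\times H$ has vertex set $V(G)\times V(H)$, with $(g,h)$ adjacent to $(g',h')$ iff $gg'\in E(G)$ and $hh'\in E(H)$. All graphs are finite, simple, with nonempty vertex sets. A partially labeled graph is a graph $K$ together with an injective map $\theta: L\to V(K)$, $L\subseteq\mathbb{N}$, whose image $\theta(L)$ is nonempty and a proper subset of $V(K)$; vertices in $\theta(L)$ are labeled. The square $KK$ is obtained from two disjoint copies of $K$ by identifying each labeled vertex $\theta(\ell)$ of the first copy with $\theta(\ell)$ of the second copy (keeping all edges, merging double edges). A graph is a square if it is isomorphic to $KK$ for some partially labeled graph $K$. -}

module Defs where

open import Data.Nat using (ℕ; _*_)
open import Data.Fin using (Fin)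
open import Data.Fin.Properties using (*↔×)
open import Data.Bool using (Bool; true; false; _∧_)
open import Data.Product using (Σ; _×_; _,_; proj₁; proj₂)
open import Data.Sum using (_⊎_; inj₁; inj₂)
open import Function.Bundles using (_↔_; Inverse)
open import Function.Properties.Inverse using (↔-trans)
open import Data.Product.Function.NonDependent.Propositional using (_×-↔_)
open import Relation.Binary.PropositionalEquality using (_≡_; refl; cong₂)

record Graph : Set₁ where
  field
    V        : Set
    size     : ℕ
    enum     : Fin size ↔ V
    vertex   : V
    adj      : V → V → Bool
    adj-sym  : ∀ u v → adj u v ≡ adj v u
    adj-irr  : ∀ v → adj v v ≡ false

open Graph public

_⊗_ : Graph → Graph → Graph
G ⊗ H = record
  { V       = V G × V H
  ; size    = size G * size H
  ; enum    = ↔-trans *↔× (enum G ×-↔ enum H)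
  ; vertex  = vertex G , vertex H
  ; adj     = λ x y → adj G (proj₁ x) (proj₁ y) ∧ adj H (proj₂ x) (proj₂ y)
  ; adj-sym = λ x y → cong₂ _∧_ (adj-sym G (proj₁ x) (proj₁ y)) (adj-sym H (proj₂ x) (proj₂ y))
  ; adj-irr = λ x → irr (adj G (proj₁ x) (proj₁ x)) (adj H (proj₂ x) (proj₂ x)) (adj-irr G (proj₁ x))
  }
  where
    irr : ∀ a b → a ≡ false → a ∧ b ≡ false
    irr .false b refl = refl

-- The square KK of a partially labeled graph (K, θ).  Only the set of labeled
-- vertices S = θ(L) matters for the construction, given as a Bool predicate
-- `lab`.  Vertices of KK: the first copy of K (inj₁), plus the unlabeled
-- vertices of the second copy (inj₂); the labeled vertices of the second copy
-- are identified with those of the first copy.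
SqV : (K : Graph) → (V K → Bool) → Set
SqV K lab = V K ⊎ Σ (V K) (λ v → lab v ≡ false)

-- Edges of KK (all edges of both copies kept, double edges merged).
sqAdj : (K : Graph) (lab : V K → Bool) → SqV K lab → SqV K lab → Bool
sqAdj K lab (inj₁ u)       (inj₁ v)       = adj K u v
sqAdj K lab (inj₁ u)       (inj₂ (v , _)) = lab u ∧ adj K u v
sqAdj K lab (inj₂ (u , _)) (inj₁ v)       = lab v ∧ adj K u v
sqAdj K lab (inj₂ (u , _)) (inj₂ (v , _)) = adj K u v

record IsSquare (G : Graph) : Set₁ where
  field
    K          : Graph
    lab        : V K → Bool
    labeled    : Σ (V K) (λ v → lab v ≡ true)
    unlabeled  : Σ (V K) (λ v → lab v ≡ false)
    iso        : V G ↔ SqV K lab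
    iso-adj    : ∀ u v → adj G u v ≡ sqAdj K lab (Inverse.to iso u) (Inverse.to iso v)

{-# OPTIONS --safe #-}
module Submission where

-- The labeling of K × H that marks (k, h) exactly when k is labeled in K turns
-- (K × H)(K × H) into (KK) × H: a vertex of either copy of K × H is a vertex of
-- the corresponding copy of K paired with a vertex of H, and the labeled
-- vertices glued together are pairs whose K-component is glued in KK.

open import Defs
open import Data.Bool using (Bool; _∧_)
open import Data.Bool.Properties using (∧-assoc)
open import Data.Product using (_×_; _,_; proj₁; proj₂)
open import Data.Product.Function.NonDependent.Propositional using (_×-↔_)
open import Data.Sum using (inj₁; inj₂)
open import Function using (_∘_)
open import Function.Bundles using (_↔_; Inverse; mk↔ₛ′)
open import Function.Properties.Inverse using (↔-refl; ↔-trans)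
open import Relation.Binary.PropositionalEquality using (_≡_; refl; trans; cong)

module _ (K H : Graph) (lab : V K → Bool) where

  toSqV-⊗ : SqV K lab × V H → SqV (K ⊗ H) (lab ∘ proj₁)
  toSqV-⊗ (inj₁ u       , h) = inj₁ (u , h)
  toSqV-⊗ (inj₂ (u , p) , h) = inj₂ ((u , h) , p)

  fromSqV-⊗ : SqV (K ⊗ H) (lab ∘ proj₁) → SqV K lab × V H
  fromSqV-⊗ (inj₁ (u , h))       = inj₁ u , h
  fromSqV-⊗ (inj₂ ((u , h) , p)) = inj₂ (u , p) , h

  SqV-⊗ : (SqV K lab × V H) ↔ SqV (K ⊗ H) (lab ∘ proj₁)
  SqV-⊗ = mk↔ₛ′ toSqV-⊗ fromSqV-⊗ to∘from from∘to
    where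
    to∘from : ∀ y → toSqV-⊗ (fromSqV-⊗ y) ≡ y
    to∘from (inj₁ _) = refl
    to∘from (inj₂ _) = refl

    from∘to : ∀ x → fromSqV-⊗ (toSqV-⊗ x) ≡ x
    from∘to (inj₁ _ , _) = refl
    from∘to (inj₂ _ , _) = refl

  sqAdj-⊗ : ∀ x y h h′ →
            sqAdj K lab x y ∧ adj H h h′
              ≡ sqAdj (K ⊗ H) (lab ∘ proj₁) (toSqV-⊗ (x , h)) (toSqV-⊗ (y , h′))
  sqAdj-⊗ (inj₁ u)       (inj₁ v)       h h′ = refl
  sqAdj-⊗ (inj₁ u)       (inj₂ (v , _)) h h′ = ∧-assoc (lab u) (adj K u v) (adj H h h′)
  sqAdj-⊗ (inj₂ (u , _)) (inj₁ v)       h h′ = ∧-assoc (lab v) (adj K u v) (adj H h h′)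
  sqAdj-⊗ (inj₂ (u , _)) (inj₂ (v , _)) h h′ = refl

theorem5p5 : (G H : Graph) → IsSquare G → IsSquare (G ⊗ H)
theorem5p5 G H S = record
  { K         = K ⊗ H
  ; lab       = lab ∘ proj₁
  ; labeled   = (proj₁ labeled , vertex H) , proj₂ labeled
  ; unlabeled = (proj₁ unlabeled , vertex H) , proj₂ unlabeled
  ; iso       = ↔-trans (iso ×-↔ ↔-refl) (SqV-⊗ K H lab)
  ; iso-adj   = λ (g , h) (g′ , h′) →
      trans (cong (_∧ adj H h h′) (iso-adj g g′))
            (sqAdj-⊗ K H lab (Inverse.to iso g) (Inverse.to iso g′) h h′)
  }
  where open IsSquare S
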